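{- Let $n\ge0$. The active sites of $e\in\mathbf{I}_n(\underline{01}1)$ are exactly $\{0,1,\dots,n\}\setminus\{e_{i+1}:i\in\mathrm{Asc}(e)\}$. The active sites of $e\in\mathbf{I}_n(\underline{01}0)$ are exactly $\{0,1,\dots,n\}\setminus\{e_i:i\in\mathrm{Asc}(e)\}$. In particular, for $n\ge1$, $e_n$ is an active site of every $e\in\mathbf{I}_n(\underline{01}0)$.
   Context: $\mathbf{I}_n$ is the set of integer sequences $e_1\dots e_n$ with $0\le e_i<i$. $\mathbf{I}_n(\underline{01}1)$ is the set of $e\in\mathbf{I}_n$ with no positions $i,k$, $i+1<k$, such that $e_i<e_{i+1}=e_k$; $\mathbf{I}_n(\underline{01}0)$ is the set of $e\in\mathbf{I}_n$ with no positions $i,k$, $i+1<k$, such that $e_i=e_k<e_{i+1}$. For $p\in\{\underline{01}1,\underline{01}0\}$ and $e\in\mathbf{I}_n(p)$, a value $h\in\{0,\dots,n\}$ is an active site of $e$ if $e_1\dots e_nh\in\mathbf{I}_{n+1}(p)$. $\mathrm{Asc}(e)=\{i\in[n-1]:e_i<e_{i+1}\}$. -}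

module Defs where

open import Data.Nat using (ℕ; suc; _≤_; _<_)
open import Data.Fin using (Fin; toℕ)
open import Data.Vec using (Vec; lookup; _∷ʳ_)
open import Data.Product using (_×_; ∃-syntax)
open import Relation.Nullary using (¬_)
open import Relation.Binary.PropositionalEquality using (_≡_)

-- Sequences e₁…eₙ are vectors; 0-based index i : Fin n stands for position i+1.
-- Inversion sequence: 0 ≤ e_{i+1} < i+1, i.e. lookup e i ≤ toℕ i.
IsInv : ∀ {n} → Vec ℕ n → Set
IsInv {n} e = ∀ (i : Fin n) → lookup e i ≤ toℕ i

Avoids011 : ∀ {n} → Vec ℕ n → Set
Avoids011 {n} e = ∀ (i j k : Fin n) → toℕ j ≡ suc (toℕ i) → toℕ j < toℕ k →
  ¬ (lookup e i < lookup e j × lookup e j ≡ lookup e k)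

Avoids010 : ∀ {n} → Vec ℕ n → Set
Avoids010 {n} e = ∀ (i j k : Fin n) → toℕ j ≡ suc (toℕ i) → toℕ j < toℕ k →
  ¬ (lookup e i ≡ lookup e k × lookup e k < lookup e j)

In011 : ∀ {n} → Vec ℕ n → Set
In011 e = IsInv e × Avoids011 e

In010 : ∀ {n} → Vec ℕ n → Set
In010 e = IsInv e × Avoids010 e

ActiveSite011 : ∀ {n} → Vec ℕ n → ℕ → Set
ActiveSite011 {n} e h = h ≤ n × In011 (e ∷ʳ h)

ActiveSite010 : ∀ {n} → Vec ℕ n → ℕ → Set
ActiveSite010 {n} e h = h ≤ n × In010 (e ∷ʳ h)

IsAscent : ∀ {n} → Vec ℕ n → Fin n → Fin n → Set
IsAscent e i j = toℕ j ≡ suc (toℕ i) × lookup e i < lookup e j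

AscTopValue : ∀ {n} → Vec ℕ n → ℕ → Set
AscTopValue {n} e h = ∃[ i ] ∃[ j ] (IsAscent {n} e i j × lookup e j ≡ h)

AscBottomValue : ∀ {n} → Vec ℕ n → ℕ → Set
AscBottomValue {n} e h = ∃[ i ] ∃[ j ] (IsAscent {n} e i j × lookup e i ≡ h)

module Submission where

-- Both patterns 01̲1 and 01̲0 are consecutive-plus-one patterns:
-- an occurrence is a triple of positions i, i+1, k with i+1 < k whose values
-- satisfy a fixed ternary relation R.  For any such R, an occurrence in the
-- extension e ∷ʳ h either lies inside e or ends at the new last position; so
-- e ∷ʳ h avoids R iff e avoids R and h does not complete an adjacent pair
-- (e_i, e_{i+1}) to an occurrence (lemma avoids-∷ʳ).  Together with the fact
-- that appending h ≤ n keeps an inversion sequence, this shows that the active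
-- sites of an R-avoiding inversion sequence are exactly the h ≤ n completing
-- no adjacent pair (activeSites).  For 01̲1 the completing values are the tops
-- e_{i+1} of ascents, for 01̲0 the bottoms e_i.  Finally, the last entry of an
-- 01̲0-avoiding sequence is never an ascent bottom, since an ascent i, i+1
-- with e_i = e_n would be an occurrence at positions i, i+1, n.

open import Defs
open import Data.Nat using (ℕ; suc; _≤_; _<_)
open import Data.Nat.Properties using (<-irrefl; <-trans; <-≤-trans; n<1+n; m≤n⇒m≤1+n)
open import Data.Fin using (Fin; zero; suc; toℕ; fromℕ; inject₁)
open import Data.Fin.Properties using (toℕ-inject₁; toℕ-fromℕ; toℕ<n; toℕ≤pred[n]; inject₁ℕ<)
open import Data.Fin.Relation.Unary.Top using (view; ‵fromℕ; ‵inject₁)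
open import Data.Vec using (Vec; []; _∷_; lookup; _∷ʳ_)
open import Data.Product using (_×_; _,_; proj₂; ∃-syntax)
open import Data.Product.Function.NonDependent.Propositional using (_×-⇔_)
open import Data.Empty using (⊥-elim)
open import Relation.Nullary using (¬_)
open import Relation.Binary.PropositionalEquality using (_≡_; refl; sym; subst)
open import Function.Bundles using (_⇔_; mk⇔; Equivalence)
open import Function.Related.TypeIsomorphisms using (¬-cong-⇔)
import Function.Properties.Equivalence as ⇔

open Equivalence using (to; from)

lookup-∷ʳ-inject₁ : ∀ {n} (e : Vec ℕ n) h (i : Fin n) → lookup (e ∷ʳ h) (inject₁ i) ≡ lookup e i
lookup-∷ʳ-inject₁ (x ∷ e) h zero    = refl
lookup-∷ʳ-inject₁ (x ∷ e) h (suc i) = lookup-∷ʳ-inject₁ e h i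

lookup-∷ʳ-last : ∀ {n} (e : Vec ℕ n) h → lookup (e ∷ʳ h) (fromℕ n) ≡ h
lookup-∷ʳ-last []      h = refl
lookup-∷ʳ-last (x ∷ e) h = lookup-∷ʳ-last e h

below-last : ∀ {n} (x : Fin (suc n)) → toℕ x < n → ∃[ y ] x ≡ inject₁ y
below-last x x<n with view x
... | ‵inject₁ y = y , refl
... | ‵fromℕ     = ⊥-elim (<-irrefl (toℕ-fromℕ _) x<n)

isInv-∷ʳ : ∀ {n} (e : Vec ℕ n) h → IsInv e → h ≤ n → IsInv (e ∷ʳ h)
isInv-∷ʳ {n} e h inv h≤n x with view x
... | ‵inject₁ i rewrite lookup-∷ʳ-inject₁ e h i | toℕ-inject₁ i = inv i
... | ‵fromℕ     rewrite lookup-∷ʳ-last e h | toℕ-fromℕ n = h≤n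

leading-positions : ∀ {n} (i j k : Fin (suc n)) → toℕ j ≡ suc (toℕ i) → toℕ j < toℕ k →
  ∃[ i′ ] ∃[ j′ ] (i ≡ inject₁ i′ × j ≡ inject₁ j′)
leading-positions {n} i j k adj j<k =
  let (i′ , i≡) = below-last i (<-trans i<j j<n)
      (j′ , j≡) = below-last j j<n
  in  i′ , j′ , i≡ , j≡
  where
  j<n : toℕ j < n
  j<n = <-≤-trans j<k (toℕ≤pred[n] k)
  i<j : toℕ i < toℕ j
  i<j = subst (toℕ i <_) (sym adj) (n<1+n (toℕ i))

-- A pattern is a relation on the values at positions i, i+1 and k > i+1.
Pattern : Set₁
Pattern = ℕ → ℕ → ℕ → Set

Occurrence : Pattern → ∀ {n} → Vec ℕ n → Fin n → Fin n → Fin n → Set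
Occurrence R e i j k =
  toℕ j ≡ suc (toℕ i) × toℕ j < toℕ k × R (lookup e i) (lookup e j) (lookup e k)

-- Stated in the curried form used by Avoids011 and Avoids010.
Avoids : Pattern → ∀ {n} → Vec ℕ n → Set
Avoids R {n} e = ∀ (i j k : Fin n) → toℕ j ≡ suc (toℕ i) → toℕ j < toℕ k →
  ¬ R (lookup e i) (lookup e j) (lookup e k)

no-occurrence : ∀ R {n} (e : Vec ℕ n) → Avoids R e → ∀ i j k → ¬ Occurrence R e i j k
no-occurrence R e av i j k (adj , j<k , occ) = av i j k adj j<k occ

Completes : Pattern → ∀ {n} → Vec ℕ n → ℕ → Set
Completes R e h = ∃[ i ] ∃[ j ] (toℕ j ≡ suc (toℕ i) × R (lookup e i) (lookup e j) h)

occurrence-inject₁ : ∀ R {n} (e : Vec ℕ n) h (i j k : Fin n) →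
  Occurrence R e i j k ⇔ Occurrence R (e ∷ʳ h) (inject₁ i) (inject₁ j) (inject₁ k)
occurrence-inject₁ R e h i j k
  rewrite toℕ-inject₁ i | toℕ-inject₁ j | toℕ-inject₁ k
        | lookup-∷ʳ-inject₁ e h i | lookup-∷ʳ-inject₁ e h j | lookup-∷ʳ-inject₁ e h k
  = ⇔.refl

occurrence-last : ∀ R {n} (e : Vec ℕ n) h (i j : Fin n) →
  (toℕ j ≡ suc (toℕ i) × R (lookup e i) (lookup e j) h)
    ⇔ Occurrence R (e ∷ʳ h) (inject₁ i) (inject₁ j) (fromℕ n)
occurrence-last R {n} e h i j
  rewrite toℕ-inject₁ i | toℕ-inject₁ j | toℕ-fromℕ n
        | lookup-∷ʳ-inject₁ e h i | lookup-∷ʳ-inject₁ e h j | lookup-∷ʳ-last e h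
  = mk⇔ (λ (adj , occ) → adj , toℕ<n j , occ) (λ (adj , _ , occ) → adj , occ)

-- An occurrence in e ∷ʳ h has its first two positions in e (leading-positions);
-- it lies inside e or its third position is the new last one.
avoids-∷ʳ : ∀ R {n} (e : Vec ℕ n) h → Avoids R (e ∷ʳ h) ⇔ (Avoids R e × ¬ Completes R e h)
avoids-∷ʳ R {n} e h = mk⇔ restrict extend
  where
  restrict : Avoids R (e ∷ʳ h) → Avoids R e × ¬ Completes R e h
  restrict av =
      (λ i j k adj j<k occ → no-occurrence R (e ∷ʳ h) av (inject₁ i) (inject₁ j) (inject₁ k)
                               (to (occurrence-inject₁ R e h i j k) (adj , j<k , occ)))
    , (λ (i , j , completion) → no-occurrence R (e ∷ʳ h) av (inject₁ i) (inject₁ j) (fromℕ n)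
                                  (to (occurrence-last R e h i j) completion))

  extend : Avoids R e × ¬ Completes R e h → Avoids R (e ∷ʳ h)
  extend (av , no-completion) i j k adj j<k occ
    with leading-positions i j k adj j<k | view k
  ... | i′ , j′ , refl , refl | ‵inject₁ k′ =
    no-occurrence R e av i′ j′ k′ (from (occurrence-inject₁ R e h i′ j′ k′) (adj , j<k , occ))
  ... | i′ , j′ , refl , refl | ‵fromℕ =
    no-completion (i′ , j′ , from (occurrence-last R e h i′ j′) (adj , j<k , occ))

ActiveSite : Pattern → ∀ {n} → Vec ℕ n → ℕ → Set
ActiveSite R {n} e h = h ≤ n × IsInv (e ∷ʳ h) × Avoids R (e ∷ʳ h)

activeSites : ∀ R {n} (e : Vec ℕ n) → IsInv e → Avoids R e → (h : ℕ) →
  ActiveSite R e h ⇔ (h ≤ n × ¬ Completes R e h)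
activeSites R e inv av h = mk⇔
  (λ (h≤n , _ , av′) → h≤n , proj₂ (to (avoids-∷ʳ R e h) av′))
  (λ (h≤n , no-completion) → h≤n , isInv-∷ʳ e h inv h≤n , from (avoids-∷ʳ R e h) (av , no-completion))

Pattern011 : Pattern
Pattern011 a b c = a < b × b ≡ c

completes011⇔ascTop : ∀ {n} (e : Vec ℕ n) h → Completes Pattern011 e h ⇔ AscTopValue e h
completes011⇔ascTop e h = mk⇔
  (λ (i , j , adj , eᵢ<eⱼ , eⱼ≡h) → i , j , (adj , eᵢ<eⱼ) , eⱼ≡h)
  (λ (i , j , (adj , eᵢ<eⱼ) , eⱼ≡h) → i , j , adj , eᵢ<eⱼ , eⱼ≡h)

Pattern010 : Pattern
Pattern010 a b c = a ≡ c × c < b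

completes010⇔ascBottom : ∀ {n} (e : Vec ℕ n) h → Completes Pattern010 e h ⇔ AscBottomValue e h
completes010⇔ascBottom e h = mk⇔
  (λ { (i , j , adj , refl , eᵢ<eⱼ) → i , j , (adj , eᵢ<eⱼ) , refl })
  (λ { (i , j , (adj , eᵢ<eⱼ) , refl) → i , j , adj , refl , eᵢ<eⱼ })

last-not-ascBottom : ∀ m (e : Vec ℕ (suc m)) → Avoids010 e → ¬ AscBottomValue e (lookup e (fromℕ m))
last-not-ascBottom m e av (i , j , (adj , eᵢ<eⱼ) , eᵢ≡last) with view j
... | ‵fromℕ      = <-irrefl eᵢ≡last eᵢ<eⱼ
... | ‵inject₁ j′ = av i (inject₁ j′) (fromℕ m) adj
                      (subst (toℕ (inject₁ j′) <_) (sym (toℕ-fromℕ m)) (inject₁ℕ< j′))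
                      (eᵢ≡last , subst (_< lookup e (inject₁ j′)) eᵢ≡last eᵢ<eⱼ)

lemma3p13 : ((n : ℕ) (e : Vec ℕ n) → In011 e → (h : ℕ) →
    ActiveSite011 e h ⇔ (h ≤ n × ¬ AscTopValue e h))
    × ((n : ℕ) (e : Vec ℕ n) → In010 e → (h : ℕ) →
    ActiveSite010 e h ⇔ (h ≤ n × ¬ AscBottomValue e h))
    × ((m : ℕ) (e : Vec ℕ (suc m)) → In010 e → ActiveSite010 e (lookup e (fromℕ m)))
lemma3p13 = activeSites011 , activeSites010 , lastIsActive010
  where
  activeSites011 : (n : ℕ) (e : Vec ℕ n) → In011 e → (h : ℕ) →
    ActiveSite011 e h ⇔ (h ≤ n × ¬ AscTopValue e h)
  activeSites011 n e (inv , av) h =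
    ⇔.trans (activeSites Pattern011 e inv av h) (⇔.refl ×-⇔ ¬-cong-⇔ (completes011⇔ascTop e h))

  activeSites010 : (n : ℕ) (e : Vec ℕ n) → In010 e → (h : ℕ) →
    ActiveSite010 e h ⇔ (h ≤ n × ¬ AscBottomValue e h)
  activeSites010 n e (inv , av) h =
    ⇔.trans (activeSites Pattern010 e inv av h) (⇔.refl ×-⇔ ¬-cong-⇔ (completes010⇔ascBottom e h))

  -- e_n ≤ n - 1 < n + 1, and e_n is no ascent bottom.
  lastIsActive010 : (m : ℕ) (e : Vec ℕ (suc m)) → In010 e → ActiveSite010 e (lookup e (fromℕ m))
  lastIsActive010 m e (inv , av) =
    from (activeSites010 (suc m) e (inv , av) (lookup e (fromℕ m)))
      ( m≤n⇒m≤1+n (subst (lookup e (fromℕ m) ≤_) (toℕ-fromℕ m) (inv (fromℕ m)))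
      , last-not-ascBottom m e av)
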